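{- Let $X$ be a Noetherian topological space, let $f:X\longrightarrow X$ be a continuous function, let $\{x_{ -n}\}_{n\ge 0}$ be a coherent backward orbit of a point $x\in X$, and let $Y\subseteq X$ be a closed set. If the set $S:=\{n\in\mathbb{N}\colon x_{ -n}\in Y\}$ has positive Banach density, then it contains an infinite arithmetic progression.
   Context: A topological space is Noetherian if it has no infinite strictly descending chain of closed subsets. A coherent backward orbit of $x$ with respect to $f$ is a sequence $\{x_{ -n}\}_{n\ge 0}$ with $x_0=x$ and $f(x_{ -n-1})=x_{ -n}$ for all $n\ge 0$. For $S\subseteq\mathbb{N}$, the Banach density is $\delta(S):=\limsup_{|I|\to\infty}\frac{|S\cap I|}{|I|}$, the $\limsup$ taken over intervals $I$ of natural numbers. An infinite arithmetic progression is a set $\{an+b\colon n\ge 0\}$ with $a,b\in\mathbb{N}$, $a\ge 1$. -}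

module Defs where

open import Level using (0ℓ) renaming (suc to lsuc)
open import Data.Nat using (ℕ; zero; suc; _+_; _*_; _≤_; _<_)
open import Data.Fin using (Fin)
open import Data.Empty using (⊥)
open import Data.Unit using (⊤)
open import Data.Product using (Σ; _×_; ∃; ∃-syntax)
open import Function.Definitions using (Injective)
open import Relation.Binary.PropositionalEquality using (_≡_)
open import Relation.Nullary using (¬_)
open import Relation.Unary using (Pred; _⊆_; _∪_; _∈_)

record Topology (X : Set) : Set₁ where
  field
    IsClosed       : Pred X 0ℓ → Set
    closed-resp    : ∀ {A B : Pred X 0ℓ} → A ⊆ B → B ⊆ A → IsClosed A → IsClosed B
    closed-empty   : IsClosed (λ _ → ⊥)
    closed-full    : IsClosed (λ _ → ⊤)
    closed-∪       : ∀ {A B : Pred X 0ℓ} → IsClosed A → IsClosed B → IsClosed (A ∪ B)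
    closed-⋂       : ∀ {I : Set} (F : I → Pred X 0ℓ) → (∀ i → IsClosed (F i)) →
                     IsClosed (λ x → ∀ i → F i x)

open Topology public

Continuous : {X : Set} → Topology X → (X → X) → Set₁
Continuous τ f = ∀ (A : Pred _ 0ℓ) → IsClosed τ A → IsClosed τ (λ x → f x ∈ A)

Noetherian : {X : Set} → Topology X → Set₁
Noetherian {X} τ =
  ¬ (Σ (ℕ → Pred X 0ℓ) λ C →
       (∀ n → IsClosed τ (C n)) ×
       (∀ n → C (suc n) ⊆ C n) ×
       (∀ n → ¬ (C n ⊆ C (suc n))))

-- Coherent backward orbit of x w.r.t. f : orb n stands for x_{-n}.
CoherentBackwardOrbit : {X : Set} → (X → X) → X → (ℕ → X) → Set
CoherentBackwardOrbit f x orb = (orb 0 ≡ x) × (∀ n → f (orb (suc n)) ≡ orb n)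

AtLeast : ℕ → Pred ℕ 0ℓ → Set
AtLeast k P = Σ (Fin k → ℕ) λ g → Injective _≡_ _≡_ g × (∀ i → P (g i))

InInterval : Pred ℕ 0ℓ → ℕ → ℕ → Pred ℕ 0ℓ
InInterval S a len n = (a ≤ n) × (n < a + len) × S n

-- Positive Banach density, unfolded:  limsup_{|I|→∞} |S∩I|/|I| > 0  iff
-- there is a rational ε = p/q > 0 such that for every L there is an interval
-- I of length ≥ L with |S ∩ I| ≥ ε |I|, i.e. q·|S∩I| ≥ p·|I|.
PositiveBanachDensity : Pred ℕ 0ℓ → Set
PositiveBanachDensity S =
  Σ ℕ λ p → Σ ℕ λ q → (1 ≤ p) × (1 ≤ q) ×
    (∀ L → Σ ℕ λ a → Σ ℕ λ len → (L ≤ len) ×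
       Σ ℕ λ k → (p * len ≤ q * k) × AtLeast k (InInterval S a len))

ContainsInfiniteAP : Pred ℕ 0ℓ → Set
ContainsInfiniteAP S = Σ ℕ λ a → Σ ℕ λ b → (1 ≤ a) × (∀ n → S (a * n + b))

-- As S has positive upper Banach density, some gap
-- d ≥ 1 recurs with positive density, i.e. S ∩ (S − d) has positive density: otherwise, for a
-- suitable H, the elements of S followed by another one within H steps are sparse, while the
-- remaining ones are H-separated, which is too few to make up the density of S.
-- If Y ⊆ f⁻ᵈ(Y), then S is closed under n ↦ n − d; an infinite such set meets some residue
-- class mod d infinitely often and therefore contains all of it, an arithmetic progression.
-- Otherwise Y ∩ f⁻ᵈ(Y) is a proper closed subset of Y whose set of times contains the shift
-- of S ∩ (S − d) by d, so a counterexample Y would yield a smaller one, and iterating gives a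
-- strictly descending chain of closed sets, which a Noetherian space does not have.
{-# OPTIONS --safe #-}
module Submission where

open import Level using (0ℓ; lift; lower) renaming (suc to lsuc)
open import Axiom.ExcludedMiddle using (ExcludedMiddle)
open import Algebra.Properties.CommutativeSemigroup using (interchange)
open import Data.Bool using (true; false; if_then_else_)
open import Data.Fin using (Fin; fromℕ<)
import Data.Fin as Fin
open import Data.Fin.Properties using (injective⇒≤; fromℕ<-injective)
open import Data.Nat using (ℕ; zero; suc; _+_; _*_; _∸_; _≤_; _<_; _≤′_; ≤′-refl; ≤′-step;
                            z≤n; s≤s; z<s; s<s; s≤s⁻¹; NonZero; >-nonZero; >-nonZero⁻¹)
open import Data.Nat.DivMod using (_/_; _%_; m≡m%n+[m/n]*n; m%n<n; m/n*n≤m; m*n/n≡m; /-monoˡ-≤)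
open import Data.Nat.GeneralisedArithmetic using (fold)
open import Data.Nat.Properties
open import Data.Nat.Tactic.RingSolver using (solve-∀)
open import Data.Product using (Σ; _×_; _,_; proj₁; proj₂)
open import Data.Sum using (_⊎_; inj₁; inj₂)
open import Function.Base using (_∘_)
open import Function.Definitions using (Injective)
open import Relation.Binary.PropositionalEquality
open import Relation.Binary.Definitions using (tri<; tri≈; tri>)
open import Relation.Nullary using (Dec; yes; no; ¬_; contradiction)
open import Relation.Nullary.Decidable using (map′; decidable-stable)
open import Relation.Unary using (Pred; _∈_; _⊆_; _⊂_; _∩_)
open import Defs

closed-∩ : ∀ {X} (τ : Topology X) {A B : Pred X 0ℓ} →
  IsClosed τ A → IsClosed τ B → IsClosed τ (A ∩ B)
closed-∩ τ {A} {B} closed-A closed-B =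
  closed-resp τ (λ A∩B → A∩B true , A∩B false) (λ { (a , b) true → a ; (a , b) false → b })
    (closed-⋂ τ (λ i → if i then A else B) λ { true → closed-A ; false → closed-B })

closed-preimage-iterate : ∀ {X} (τ : Topology X) {f : X → X} → Continuous τ f →
  ∀ d {A} → IsClosed τ A → IsClosed τ (λ x → fold x f d ∈ A)
closed-preimage-iterate τ cont zero    closed-A = closed-A
closed-preimage-iterate τ cont (suc d) {A} closed-A = closed-preimage-iterate τ cont d (cont A closed-A)

ap-mono : ∀ {P Q : Pred ℕ 0ℓ} → P ⊆ Q → ContainsInfiniteAP P → ContainsInfiniteAP Q
ap-mono P⊆Q (a , b , 1≤a , ap) = a , b , 1≤a , λ n → P⊆Q (ap n)

noetherian-descent : ∀ {X} (τ : Topology X) → Noetherian τ → (Good : Pred X 0ℓ → Set) →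
  (∀ {Y} → IsClosed τ Y → Good Y → Σ (Pred X 0ℓ) λ Y′ → IsClosed τ Y′ × Good Y′ × Y′ ⊂ Y) →
  ∀ {Y} → IsClosed τ Y → ¬ Good Y
noetherian-descent {X} τ noetherian Good shrink {Y} closed-Y good-Y =
  noetherian ((proj₁ ∘ chain) , (proj₁ ∘ proj₂ ∘ chain) ,
              (λ n → proj₁ (next-⊂ (chain n))) , (λ n → proj₂ (next-⊂ (chain n))))
  where
  GoodClosed : Set₁
  GoodClosed = Σ (Pred X 0ℓ) λ Y → IsClosed τ Y × Good Y
  next : GoodClosed → GoodClosed
  next (_ , closed , good) = let (Y′ , closed′ , good′ , _) = shrink closed good in Y′ , closed′ , good′
  next-⊂ : ∀ C → proj₁ (next C) ⊂ proj₁ C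
  next-⊂ (_ , closed , good) = proj₂ (proj₂ (proj₂ (shrink closed good)))
  chain : ℕ → GoodClosed
  chain = fold (Y , closed-Y , good-Y) next

orbit-iterate : ∀ {X : Set} {f : X → X} {orb : ℕ → X} → (∀ n → f (orb (suc n)) ≡ orb n) →
  ∀ d m → fold (orb (m + d)) f d ≡ orb m
orbit-iterate {orb = orb} coh zero    m = cong orb (+-identityʳ m)
orbit-iterate {f = f} {orb} coh (suc d) m = begin
  f (fold (orb (m + suc d)) f d)   ≡⟨ cong (λ n → f (fold (orb n) f d)) (+-suc m d) ⟩
  f (fold (orb (suc m + d)) f d)   ≡⟨ cong f (orbit-iterate coh d (suc m)) ⟩
  f (orb (suc m))                  ≡⟨ coh m ⟩
  orb m                            ∎
  where open ≡-Reasoning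

module Classical (em : ExcludedMiddle (lsuc 0ℓ)) where

  dec : {P : Set} → Dec P
  dec = map′ lower lift em

  ¬¬-elim : {P : Set} → ¬ ¬ P → P
  ¬¬-elim = decidable-stable dec

  ¬∀⇒∃¬ : {A : Set} {B : A → Set} → ¬ (∀ x → B x) → Σ A λ x → ¬ B x
  ¬∀⇒∃¬ ¬∀ = ¬¬-elim λ ¬∃ → ¬∀ λ x → ¬¬-elim λ ¬b → ¬∃ (x , ¬b)

  indicator : {A : Set} → Dec A → ℕ
  indicator (yes _) = 1
  indicator (no _)  = 0

  count : Pred ℕ 0ℓ → ℕ → ℕ → ℕ
  count P a zero    = 0
  count P a (suc n) = indicator (dec {P a}) + count P (suc a) n

  count-+ : ∀ P a m n → count P a (m + n) ≡ count P a m + count P (a + m) n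
  count-+ P a zero    n = cong (λ b → count P b n) (sym (+-identityʳ a))
  count-+ P a (suc m) n = begin
    ι + count P (suc a) (m + n)                       ≡⟨ cong (ι +_) (count-+ P (suc a) m n) ⟩
    ι + (count P (suc a) m + count P (suc a + m) n)   ≡⟨ sym (+-assoc ι _ _) ⟩
    ι + count P (suc a) m + count P (suc a + m) n     ≡⟨ cong (ι + count P (suc a) m +_) (cong (λ b → count P b n) (sym (+-suc a m))) ⟩
    ι + count P (suc a) m + count P (a + suc m) n     ∎
    where
    open ≡-Reasoning
    ι = indicator (dec {P a})

  count-mono : ∀ P a {m n} → m ≤ n → count P a m ≤ count P a n
  count-mono P a {m} m≤n with m≤n⇒∃[o]m+o≡n m≤n
  ... | e , refl = subst (count P a m ≤_) (sym (count-+ P a m e)) (m≤m+n _ _)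

  count≡0 : ∀ {P a n} → (∀ {i} → i < n → ¬ P (a + i)) → count P a n ≡ 0
  count≡0 {n = zero}        _     = refl
  count≡0 {P} {a} {suc n} empty with dec {P a}
  ... | yes Pa = contradiction (subst P (sym (+-identityʳ a)) Pa) (empty z<s)
  ... | no  _  = count≡0 λ {i} i<n Pa+i → empty (s<s i<n) (subst P (sym (+-suc a i)) Pa+i)

  count-pos : ∀ {P a} n → P a → 1 ≤ count P a (suc n)
  count-pos {P} {a} n Pa with dec {P a}
  ... | yes _  = s≤s z≤n
  ... | no ¬Pa = contradiction Pa ¬Pa

  count-strict : ∀ {P a j j′} → P (a + j) → j < j′ → count P a j < count P a j′
  count-strict {P} {a} {j} Pa+j j<j′ with m≤n⇒∃[o]m+o≡n j<j′
  ... | e , refl = begin-strict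
    count P a j                              <⟨ m<m+n _ (count-pos e Pa+j) ⟩
    count P a j + count P (a + j) (suc e)    ≡⟨ sym (count-+ P a j (suc e)) ⟩
    count P a (j + suc e)                    ≡⟨ cong (count P a) (+-suc j e) ⟩
    count P a (suc j + e)                    ∎
    where open ≤-Reasoning

  indicator-⊆-∪ : ∀ {A B C : Set} → (A → B ⊎ C) →
    indicator (dec {A}) ≤ indicator (dec {B}) + indicator (dec {C})
  indicator-⊆-∪ {A} {B} {C} split with dec {A} | dec {B} | dec {C}
  ... | no  _ | _     | _     = z≤n
  ... | yes _ | yes _ | _     = s≤s z≤n
  ... | yes _ | no  _ | yes _ = s≤s z≤n
  ... | yes a | no ¬b | no ¬c with split a
  ...   | inj₁ b = contradiction b ¬b
  ...   | inj₂ c = contradiction c ¬c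

  count-⊆-∪ : ∀ {P Q R} → (∀ {m} → P m → Q m ⊎ R m) →
    ∀ a n → count P a n ≤ count Q a n + count R a n
  count-⊆-∪ split a zero    = z≤n
  count-⊆-∪ {P} {Q} {R} split a (suc n) = begin
    indicator (dec {P a}) + count P (suc a) n
      ≤⟨ +-mono-≤ (indicator-⊆-∪ split) (count-⊆-∪ split (suc a) n) ⟩
    (indicator (dec {Q a}) + indicator (dec {R a})) + (count Q (suc a) n + count R (suc a) n)
      ≡⟨ interchange +-commutativeSemigroup (indicator (dec {Q a})) _ _ _ ⟩
    count Q a (suc n) + count R a (suc n) ∎
    where open ≤-Reasoning

  count-shift : ∀ {P Q} d → (∀ {m} → P m → Q (m + d)) → ∀ a n → count P a n ≤ count Q (a + d) n
  count-shift d P⇒Q a zero = z≤n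
  count-shift {P} {Q} d P⇒Q a (suc n) with dec {P a} | dec {Q (a + d)}
  ... | yes Pa | no ¬Q = contradiction (P⇒Q Pa) ¬Q
  ... | yes _  | yes _ = s≤s (count-shift d P⇒Q (suc a) n)
  ... | no  _  | yes _ = m≤n⇒m≤1+n (count-shift d P⇒Q (suc a) n)
  ... | no  _  | no  _ = count-shift d P⇒Q (suc a) n

  atLeast⇒≤count : ∀ {P a len k} → AtLeast k (InInterval P a len) → k ≤ count P a len
  atLeast⇒≤count {P} {a} {len} {k} (g , g-inj , g∈) = injective⇒≤ rank-injective
    where
    offset : Fin k → ℕ
    offset i = g i ∸ a
    a+offset : ∀ i → a + offset i ≡ g i
    a+offset i = m+[n∸m]≡n (proj₁ (g∈ i))
    P-offset : ∀ i → P (a + offset i)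
    P-offset i = subst P (sym (a+offset i)) (proj₂ (proj₂ (g∈ i)))
    rank< : ∀ i → count P a (offset i) < count P a len
    rank< i = count-strict (P-offset i)
      (+-cancelˡ-< a _ _ (subst (_< a + len) (sym (a+offset i)) (proj₁ (proj₂ (g∈ i)))))
    rank : Fin k → Fin (count P a len)
    rank i = fromℕ< (rank< i)
    offset-injective : ∀ {i j} → count P a (offset i) ≡ count P a (offset j) → offset i ≡ offset j
    offset-injective {i} {j} eq with <-cmp (offset i) (offset j)
    ... | tri< lt _ _ = contradiction eq (<⇒≢ (count-strict (P-offset i) lt))
    ... | tri≈ _ e _  = e
    ... | tri> _ _ gt = contradiction (sym eq) (<⇒≢ (count-strict (P-offset j) gt))
    rank-injective : Injective _≡_ _≡_ rank
    rank-injective {i} {j} eq = g-inj (begin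
      g i              ≡⟨ sym (a+offset i) ⟩
      a + offset i     ≡⟨ cong (a +_) (offset-injective (fromℕ<-injective _ _ (rank< i) (rank< j) eq)) ⟩
      a + offset j     ≡⟨ a+offset j ⟩
      g j              ∎)
      where open ≡-Reasoning

  inInterval-widen : ∀ {P a len m} → InInterval P (suc a) len m → InInterval P a (suc len) m
  inInterval-widen {a = a} {len} {m} (a<m , m<a+len , Pm) =
    <⇒≤ a<m , subst (m <_) (sym (+-suc a len)) m<a+len , Pm

  atLeast-count : ∀ P a len → AtLeast (count P a len) (InInterval P a len)
  atLeast-count P a zero = (λ ()) , (λ {i} → λ { {()} }) , λ ()
  atLeast-count P a (suc len) with dec {P a} | atLeast-count P (suc a) len
  ... | no  _  | g , g-inj , g∈ = g , g-inj , λ i → inInterval-widen {P} (g∈ i)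
  ... | yes Pa | g , g-inj , g∈ = g′ , g′-inj , g′∈
    where
    g′ : Fin (suc (count P (suc a) len)) → ℕ
    g′ Fin.zero    = a
    g′ (Fin.suc i) = g i
    g′-inj : Injective _≡_ _≡_ g′
    g′-inj {Fin.zero}  {Fin.zero}  _ = refl
    g′-inj {Fin.zero}  {Fin.suc j} e = contradiction e (<⇒≢ (proj₁ (g∈ j)))
    g′-inj {Fin.suc i} {Fin.zero}  e = contradiction (sym e) (<⇒≢ (proj₁ (g∈ i)))
    g′-inj {Fin.suc i} {Fin.suc j} e = cong Fin.suc (g-inj e)
    g′∈ : ∀ i → InInterval P a (suc len) (g′ i)
    g′∈ Fin.zero    = ≤-refl , subst (a <_) (sym (+-suc a len)) (s≤s (m≤m+n a len)) , Pa
    g′∈ (Fin.suc i) = inInterval-widen {P} (g∈ i)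

  atLeast⇒∃≥ : ∀ {P K k} → K < k → AtLeast k P → Σ ℕ λ m → K ≤ m × P m
  atLeast⇒∃≥ {P} {K} {k} K<k (g , g-inj , g∈P) = ¬¬-elim λ none →
    let g<K : ∀ i → g i < K
        g<K i = ≰⇒> λ K≤gi → none (g i , K≤gi , g∈P i)
    in <⇒≱ K<k (injective⇒≤ {f = λ i → fromℕ< (g<K i)} λ eq →
                  g-inj (fromℕ<-injective _ _ (g<K _) (g<K _) eq))

  Separated : ℕ → Pred ℕ 0ℓ → Set
  Separated h P = ∀ {m m′} → P m → P m′ → m < m′ → m + h ≤ m′

  module _ {h P} (sep : Separated h P) where

    count-window≤1 : ∀ a w → w ≤ h → count P a w ≤ 1
    count-window≤1 a zero    _   = z≤n
    count-window≤1 a (suc w) w<h with dec {P a}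
    ... | no  _  = count-window≤1 (suc a) w (<⇒≤ w<h)
    ... | yes Pa = s≤s (≤-reflexive (count≡0 λ {i} i<w Pa+1+i →
                     ≤⇒≯ (sep Pa Pa+1+i (s≤s (m≤m+n a i))) (begin-strict
                       suc a + i   <⟨ +-monoʳ-< (suc a) i<w ⟩
                       suc a + w   ≡⟨ sym (+-suc a w) ⟩
                       a + suc w   ≤⟨ +-monoʳ-≤ a w<h ⟩
                       a + h       ∎)))
      where open ≤-Reasoning

    count-windows : ∀ a n → count P a (h * n) ≤ n
    count-windows a zero    rewrite *-zeroʳ h = z≤n
    count-windows a (suc n) rewrite *-suc h n | count-+ P a h (h * n) =
      +-mono-≤ (count-window≤1 a h ≤-refl) (count-windows (a + h) n)

    separated⇒count≤ : .{{_ : NonZero h}} → ∀ a len → h * count P a len ≤ len + h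
    separated⇒count≤ a len = begin
      h * count P a len                ≤⟨ *-monoʳ-≤ h (count-mono P a len≤h*[1+len/h]) ⟩
      h * count P a (h * suc (len / h)) ≤⟨ *-monoʳ-≤ h (count-windows a (suc (len / h))) ⟩
      h * suc (len / h)                ≡⟨ *-suc h (len / h) ⟩
      h + h * (len / h)                ≤⟨ +-monoʳ-≤ h (subst (_≤ len) (*-comm (len / h) h) (m/n*n≤m len h)) ⟩
      h + len                          ≡⟨ +-comm h len ⟩
      len + h                          ∎
      where
      open ≤-Reasoning
      len≤h*[1+len/h] : len ≤ h * suc (len / h)
      len≤h*[1+len/h] = begin
        len                      ≡⟨ m≡m%n+[m/n]*n len h ⟩
        len % h + len / h * h    ≤⟨ +-mono-≤ (<⇒≤ (m%n<n len h)) (≤-reflexive (*-comm (len / h) h)) ⟩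
        h + h * (len / h)        ≡⟨ sym (*-suc h (len / h)) ⟩
        h * suc (len / h)        ∎

  Dense : ℕ → Pred ℕ 0ℓ → Set
  Dense q P = ∀ L → Σ ℕ λ a → Σ ℕ λ len → L ≤ len × len ≤ q * count P a len

  record Sparse (c r : ℕ) (P : Pred ℕ 0ℓ) : Set where
    constructor sparse
    field
      threshold : ℕ
      bound     : ∀ a len → threshold ≤ len → r * count P a len ≤ c * len

  Unbounded : Pred ℕ 0ℓ → Set
  Unbounded P = ∀ K → Σ ℕ λ m → K ≤ m × P m

  pbd⇒dense : ∀ {P} → PositiveBanachDensity P → Σ ℕ λ q → Dense (suc q) P
  pbd⇒dense (p , zero , _ , () , _)
  pbd⇒dense {P} (p , suc q , 1≤p , _ , dense) = q , λ L →
    let (a , len , L≤len , k , p*len≤q*k , atLeast) = dense L in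
    a , len , L≤len , (begin
      len                  ≡⟨ sym (*-identityˡ len) ⟩
      1 * len              ≤⟨ *-monoˡ-≤ len 1≤p ⟩
      p * len              ≤⟨ p*len≤q*k ⟩
      suc q * k            ≤⟨ *-monoʳ-≤ (suc q) (atLeast⇒≤count atLeast) ⟩
      suc q * count P a len ∎)
    where open ≤-Reasoning

  dense⇒pbd : ∀ {P} q .{{_ : NonZero q}} → Dense q P → PositiveBanachDensity P
  dense⇒pbd {P} q dense = 1 , q , ≤-refl , >-nonZero⁻¹ q , λ L →
    let (a , len , L≤len , len≤) = dense L in
    a , len , L≤len , count P a len ,
    subst (_≤ q * count P a len) (sym (*-identityˡ len)) len≤ , atLeast-count P a len

  dense⇒unbounded : ∀ {P q} → Dense (suc q) P → Unbounded P
  dense⇒unbounded {P} {q} dense K with dense (suc q * suc K)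
  ... | a , len , L≤len , len≤
    with atLeast⇒∃≥ {InInterval P a len} (*-cancelˡ-≤ (suc q) (≤-trans L≤len len≤)) (atLeast-count P a len)
  ...   | m , K≤m , (_ , _ , Pm) = m , K≤m , Pm

  dense-shift : ∀ {P Q q} d → (∀ {m} → P m → Q (m + d)) → Dense q P → Dense q Q
  dense-shift {q = q} d P⇒Q dense L =
    let (a , len , L≤len , len≤) = dense L in
    a + d , len , L≤len , ≤-trans len≤ (*-monoʳ-≤ q (count-shift d P⇒Q a len))

  ¬dense⇒sparse : ∀ {P r} → ¬ Dense r P → Sparse 1 r P
  ¬dense⇒sparse ¬dense with ¬∀⇒∃¬ ¬dense
  ... | L , no-interval = sparse L λ a len L≤len →
    ≤-trans (<⇒≤ (≰⇒> λ len≤ → no-interval (a , len , L≤len , len≤)))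
            (≤-reflexive (sym (*-identityˡ len)))

  sparse-∅ : ∀ {P r} → (∀ {m} → ¬ P m) → Sparse 0 r P
  sparse-∅ {P} {r} empty = sparse 0 λ a len _ →
    ≤-reflexive (trans (cong (r *_) (count≡0 {P} {a} {len} λ _ → empty)) (*-zeroʳ r))

  sparse-∪ : ∀ {P Q R c c′ r} → (∀ {m} → P m → Q m ⊎ R m) →
    Sparse c r Q → Sparse c′ r R → Sparse (c + c′) r P
  sparse-∪ {P} {Q} {R} {c} {c′} {r} split (sparse L Q-sparse) (sparse L′ R-sparse) =
    sparse (L + L′) λ a len L+L′≤len → begin
    r * count P a len                        ≤⟨ *-monoʳ-≤ r (count-⊆-∪ split a len) ⟩
    r * (count Q a len + count R a len)      ≡⟨ *-distribˡ-+ r _ _ ⟩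
    r * count Q a len + r * count R a len    ≤⟨ +-mono-≤ (Q-sparse a len (m+n≤o⇒m≤o L L+L′≤len))
                                                         (R-sparse a len (m+n≤o⇒n≤o L L+L′≤len)) ⟩
    c * len + c′ * len                       ≡⟨ sym (*-distribʳ-+ len c c′) ⟩
    (c + c′) * len                           ∎
    where open ≤-Reasoning

  ReturnsAfter : Pred ℕ 0ℓ → ℕ → Pred ℕ 0ℓ
  ReturnsAfter T d m = T m × T (m + d)

  ReturnsWithin : Pred ℕ 0ℓ → ℕ → Pred ℕ 0ℓ
  ReturnsWithin T j m = T m × Σ ℕ λ d → 1 ≤ d × d ≤ j × T (m + d)

  Isolated : Pred ℕ 0ℓ → ℕ → Pred ℕ 0ℓ
  Isolated T j m = T m × (∀ {d} → 1 ≤ d → d ≤ j → ¬ T (m + d))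

  isolated-or-returns : ∀ {T j m} → T m → Isolated T j m ⊎ ReturnsWithin T j m
  isolated-or-returns {T} {j} {m} Tm with dec {Σ ℕ λ d → 1 ≤ d × d ≤ j × T (m + d)}
  ... | yes return    = inj₂ (Tm , return)
  ... | no  no-return = inj₁ (Tm , λ 1≤d d≤j Tm+d → no-return (_ , 1≤d , d≤j , Tm+d))

  isolated-separated : ∀ {T} j → Separated (suc j) (Isolated T j)
  isolated-separated {T} j {m} {m′} (_ , no-return) (Tm′ , _) m<m′ = ≮⇒≥ λ m′<m+1+j →
    no-return (m<n⇒0<n∸m m<m′)
      (s≤s⁻¹ (+-cancelˡ-< m _ _ (subst (_< m + suc j) (sym m+[m′∸m]≡m′) m′<m+1+j)))
      (subst T (sym m+[m′∸m]≡m′) Tm′)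
    where
    m+[m′∸m]≡m′ : m + (m′ ∸ m) ≡ m′
    m+[m′∸m]≡m′ = m+[n∸m]≡n (<⇒≤ m<m′)

  returnsWithin-sparse : ∀ {T r} j → (∀ {d} → 1 ≤ d → d ≤ j → ¬ Dense r (ReturnsAfter T d)) →
    Sparse j r (ReturnsWithin T j)
  returnsWithin-sparse zero _ = sparse-∅ λ { (_ , d , 1≤d , d≤0 , _) → <⇒≱ 1≤d d≤0 }
  returnsWithin-sparse {T} {r} (suc j) ¬dense =
    sparse-∪ split (¬dense⇒sparse (¬dense (s≤s z≤n) ≤-refl))
                   (returnsWithin-sparse j λ 1≤d d≤j → ¬dense 1≤d (m≤n⇒m≤1+n d≤j))
    where
    split : ∀ {m} → ReturnsWithin T (suc j) m → ReturnsAfter T (suc j) m ⊎ ReturnsWithin T j m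
    split (Tm , d , 1≤d , d≤1+j , Tm+d) with m≤n⇒m<n∨m≡n d≤1+j
    ... | inj₁ d<1+j = inj₂ (Tm , d , 1≤d , s≤s⁻¹ d<1+j , Tm+d)
    ... | inj₂ refl  = inj₁ (Tm , Tm+d)

  density-arithmetic : ∀ Q len k c₁ c₂ → len ≤ Q * k → k ≤ c₁ + c₂ →
    suc (3 * Q) * c₁ ≤ len + suc (3 * Q) → 3 * Q * c₂ ≤ len → len ≤ suc (3 * Q)
  density-arithmetic Q len k c₁ c₂ len≤Q*k k≤c₁+c₂ c₁-bound c₂-bound =
    +-cancelˡ-≤ len _ _ (+-cancelʳ-≤ len _ _ (begin
      len + len + len                ≡⟨ three-times len ⟩
      3 * len                        ≤⟨ *-monoʳ-≤ 3 len≤Q*k ⟩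
      3 * (Q * k)                    ≡⟨ sym (*-assoc 3 Q k) ⟩
      3 * Q * k                      ≤⟨ *-monoʳ-≤ (3 * Q) k≤c₁+c₂ ⟩
      3 * Q * (c₁ + c₂)              ≡⟨ *-distribˡ-+ (3 * Q) c₁ c₂ ⟩
      3 * Q * c₁ + 3 * Q * c₂        ≤⟨ +-mono-≤ (≤-trans (*-monoˡ-≤ c₁ (n≤1+n (3 * Q))) c₁-bound) c₂-bound ⟩
      len + suc (3 * Q) + len        ∎))
    where
    open ≤-Reasoning
    three-times : ∀ n → n + n + n ≡ 3 * n
    three-times = solve-∀

  -- If T has density ≥ 1/Q, take H = 3Q: if no gap d ≤ H recurs with density 1/H², the elements
  -- returning within H steps have density ≤ 1/H, and the isolated ones, being (H+1)-separated,
  -- also ≤ 1/H; together less than 1/Q.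
  pbd⇒pbd-returnsAfter : ∀ {T} → PositiveBanachDensity T →
    Σ ℕ λ d → 1 ≤ d × PositiveBanachDensity (ReturnsAfter T d)
  pbd⇒pbd-returnsAfter {T} pbd with pbd⇒dense pbd
  ... | q , dense = ¬¬-elim λ none →
    not-sparse (returnsWithin-sparse H λ 1≤d _ dense-d → none (_ , 1≤d , dense⇒pbd (H * H) dense-d))
    where
    H : ℕ
    H = 3 * suc q
    not-sparse : ¬ Sparse H (H * H) (ReturnsWithin T H)
    not-sparse (sparse L bound) with dense (L + suc (suc H))
    ... | a , len , L+2+H≤len , len≤ = <⇒≱ (m+n≤o⇒n≤o L L+2+H≤len)
      (density-arithmetic (suc q) len (count T a len) _ _ len≤
        (count-⊆-∪ (isolated-or-returns {T}) a len)
        (separated⇒count≤ (isolated-separated {T} H) a len)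
        (*-cancelˡ-≤ H (subst (_≤ H * len) (*-assoc H H _) (bound a len (m+n≤o⇒m≤o L L+2+H≤len)))))

  pbd⇒unbounded : ∀ {P} → PositiveBanachDensity P → Unbounded P
  pbd⇒unbounded {P} pbd = let (q , dense) = pbd⇒dense pbd in dense⇒unbounded {P} {q} dense

  residues-eventually-avoided : ∀ (T : Pred ℕ 0ℓ) d → (∀ c → ¬ Unbounded (λ j → T (d * j + c))) →
    ∀ r → Σ ℕ λ K → ∀ {j c} → K ≤ j → c < r → ¬ T (d * j + c)
  residues-eventually-avoided T d bounded zero    = 0 , λ _ ()
  residues-eventually-avoided T d bounded (suc r)
    with residues-eventually-avoided T d bounded r | ¬∀⇒∃¬ (bounded r)
  ... | K , avoid | K′ , ¬beyond = K + K′ , avoid′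
    where
    avoid′ : ∀ {j c} → K + K′ ≤ j → c < suc r → ¬ T (d * j + c)
    avoid′ {j} K+K′≤j c<1+r with m≤n⇒m<n∨m≡n (s≤s⁻¹ c<1+r)
    ... | inj₁ c<r = avoid (m+n≤o⇒m≤o K K+K′≤j) c<r
    ... | inj₂ refl = λ Tdj+r → ¬beyond (j , m+n≤o⇒n≤o K K+K′≤j , Tdj+r)

  unbounded⇒unbounded-residue : ∀ {T} d .{{_ : NonZero d}} → Unbounded T →
    Σ ℕ λ c → Unbounded (λ j → T (d * j + c))
  unbounded⇒unbounded-residue {T} d unbounded = ¬¬-elim λ none →
    let (K , avoid) = residues-eventually-avoided T d (λ c unbounded-c → none (c , unbounded-c)) d
        (m , K*d≤m , Tm) = unbounded (K * d)
    in avoid (subst (_≤ m / d) (m*n/n≡m K d) (/-monoˡ-≤ d K*d≤m)) (m%n<n m d)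
         (subst T (division m) Tm)
    where
    division : ∀ m → m ≡ d * (m / d) + m % d
    division m = begin
      m                      ≡⟨ m≡m%n+[m/n]*n m d ⟩
      m % d + m / d * d      ≡⟨ +-comm (m % d) _ ⟩
      m / d * d + m % d      ≡⟨ cong (_+ m % d) (*-comm (m / d) d) ⟩
      d * (m / d) + m % d    ∎
      where open ≡-Reasoning

  downward-closed⇒AP : ∀ {T} d → 1 ≤ d → (∀ {m} → T (m + d) → T m) → Unbounded T →
    ContainsInfiniteAP T
  downward-closed⇒AP {T} d 1≤d down unbounded
    with unbounded⇒unbounded-residue d {{>-nonZero 1≤d}} unbounded
  ... | c , unbounded-c = d , c , 1≤d , λ n →
    let (j , n≤j , Tdj+c) = unbounded-c n in descend (≤⇒≤′ n≤j) Tdj+c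
    where
    descend : ∀ {n j} → n ≤′ j → T (d * j + c) → T (d * n + c)
    descend ≤′-refl            Tdj+c = Tdj+c
    descend (≤′-step {j} n≤′j) Tdj+c = descend n≤′j (down (subst T (next d j c) Tdj+c))
      where
      next : ∀ d j c → d * suc j + c ≡ d * j + c + d
      next = solve-∀

  pbd-shift : ∀ {P Q} d → (∀ {m} → P m → Q (m + d)) → PositiveBanachDensity P → PositiveBanachDensity Q
  pbd-shift {P} {Q} d P⇒Q pbd =
    let (q , dense) = pbd⇒dense pbd in dense⇒pbd (suc q) (dense-shift {P} {Q} {suc q} d P⇒Q dense)

  module _ {X : Set} (τ : Topology X) {f : X → X} (cont : Continuous τ f) {orb : ℕ → X}
           (coh : ∀ n → f (orb (suc n)) ≡ orb n) where

    Visits : Pred X 0ℓ → Pred ℕ 0ℓ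
    Visits Y n = orb n ∈ Y

    Preimage : ℕ → Pred X 0ℓ → Pred X 0ℓ
    Preimage d Y x = fold x f d ∈ Y

    invariant⇒AP : ∀ {Y} d → 1 ≤ d → Y ⊆ Preimage d Y → PositiveBanachDensity (Visits Y) →
      ContainsInfiniteAP (Visits Y)
    invariant⇒AP {Y} d 1≤d invariant pbd =
      downward-closed⇒AP {Visits Y} d 1≤d
        (λ {m} Y∋orb[m+d] → subst Y (orbit-iterate coh d m) (invariant Y∋orb[m+d]))
        (pbd⇒unbounded {Visits Y} pbd)

    returns⇒visits-∩ : ∀ {Y} d {m} → ReturnsAfter (Visits Y) d m → Visits (Y ∩ Preimage d Y) (m + d)
    returns⇒visits-∩ {Y} d {m} (Y∋orb[m] , Y∋orb[m+d]) =
      Y∋orb[m+d] , subst Y (sym (orbit-iterate coh d m)) Y∋orb[m]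

    DenseVisitsWithoutAP : Pred X 0ℓ → Set
    DenseVisitsWithoutAP Y = PositiveBanachDensity (Visits Y) × ¬ ContainsInfiniteAP (Visits Y)

    Shrinking : Pred X 0ℓ → Set₁
    Shrinking Y = Σ (Pred X 0ℓ) λ Y′ → IsClosed τ Y′ × DenseVisitsWithoutAP Y′ × Y′ ⊂ Y

    shrink-by-returns : ∀ {Y} → IsClosed τ Y → DenseVisitsWithoutAP Y →
      (Σ ℕ λ d → 1 ≤ d × PositiveBanachDensity (ReturnsAfter (Visits Y) d)) → Shrinking Y
    shrink-by-returns {Y} closed-Y (pbd , no-AP) (d , 1≤d , pbd-returns) =
      Y ∩ Preimage d Y ,
      closed-∩ τ closed-Y (closed-preimage-iterate τ cont d closed-Y) ,
      (pbd-shift {ReturnsAfter (Visits Y) d} {Visits (Y ∩ Preimage d Y)} d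
                 (returns⇒visits-∩ {Y} d) pbd-returns ,
       no-AP ∘ ap-mono {Visits (Y ∩ Preimage d Y)} proj₁) ,
      proj₁ , λ Y⊆Y∩Y′ → no-AP (invariant⇒AP {Y} d 1≤d (λ Yx → proj₂ (Y⊆Y∩Y′ Yx)) pbd)

    dense-visits-without-AP-shrink : ∀ {Y} → IsClosed τ Y → DenseVisitsWithoutAP Y → Shrinking Y
    dense-visits-without-AP-shrink {Y} closed-Y (pbd , no-AP) =
      shrink-by-returns closed-Y (pbd , no-AP) (pbd⇒pbd-returnsAfter {Visits Y} pbd)

proposition3p3 : ExcludedMiddle (lsuc 0ℓ) →
    {X : Set} (τ : Topology X) → Noetherian τ →
    (f : X → X) → Continuous τ f →
    (x : X) (orb : ℕ → X) → CoherentBackwardOrbit f x orb →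
    (Y : Pred X 0ℓ) → IsClosed τ Y →
    PositiveBanachDensity (λ n → orb n ∈ Y) →
    ContainsInfiniteAP (λ n → orb n ∈ Y)
proposition3p3 em τ noetherian f cont x orb (_ , coh) Y closed-Y pbd =
  ¬¬-elim λ no-AP →
    noetherian-descent τ noetherian (DenseVisitsWithoutAP τ cont coh)
      (dense-visits-without-AP-shrink τ cont coh) closed-Y (pbd , no-AP)
  where open Classical em
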